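{- Let $H$, $s,t$, $P_0,P_r$ and the instance $(G,L,f_0,f_r)$ be as constructed in the context. Then there is a sequence of S-paths $P_0=Q_0,Q_1,\dots,Q_\ell=P_r$ in $H$ with $Q_{j-1}$ and $Q_j$ adjacent for every $j=1,\dots,\ell$ if and only if the reconfiguration graph $R(G,L)$ contains a path from $f_0$ to $f_r$.
   Context: Let $H$ be an unweighted graph with vertices $s,t$, and let $d=\mathrm{dist}_H(s,t)$. An S-path is a shortest $s$–$t$ path in $H$. Two S-paths $P,P'$ are adjacent if $|V(P')\setminus V(P)|=1$ and $|V(P)\setminus V(P')|=1$. Let $P_0,P_r$ be S-paths. For $i\in\{0,\dots,d\}$ let the layer $\Lambda_i=\{v\in V(H):\mathrm{dist}(s,v)=i,\ \mathrm{dist}(t,v)=d-i\}$, and for $1\le i\le d-1$ write $\Lambda_i=\{v_{i,1},\dots,v_{i,q_i}\}$. Let the colors $c_{i,j}$ ($1\le i\le d-1$, $1\le j\le q_i$) be pairwise distinct. Construct $G$ with lists $L$ as follows: for each $i\in\{1,\dots,d-1\}$ add a layer vertex $u_i$ with $L(u_i)=\{c_{i,1},\dots,c_{i,q_i}\}$; for each $i\in\{1,\dots,d-2\}$ and each pair $v_{i,x}\in\Lambda_i$, $v_{i+1,y}\in\Lambda_{i+1}$ with $v_{i,x}v_{i+1,y}\notin E(H)$, add a new (forbidden) vertex $w$ adjacent exactly to $u_i$ and $u_{i+1}$, with $L(w)=\{c_{i,x},c_{i+1,y}\}$. (No other vertices or edges.) Define $f_0$ by $f_0(u_i)=c_{i,j}$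 where $v_{i,j}$ is the vertex of $P_0$ in $\Lambda_i$, and, for each forbidden vertex $w$, $f_0(w)$ an arbitrary color of $L(w)$ not assigned to $u_i$ or $u_{i+1}$ (such a color exists); define $f_r$ analogously from $P_r$. A $k$-list coloring of $G$ is a map $f$ with $f(v)\in L(v)$ and $f(v)\ne f(w)$ for all edges $vw$; the reconfiguration graph $R(G,L)$ has the $k$-list colorings as nodes, two being adjacent iff they differ on exactly one vertex. -}

module Defs where

open import Data.Nat using (ℕ; zero; suc; _≤_; _∸_; z≤n; s≤s)
open import Data.Fin using (Fin; zero; suc; toℕ; fromℕ; inject₁)
open import Data.Vec using (Vec; lookup)
open import Data.Vec.Membership.Propositional using (_∈_; _∉_)
open import Data.Product using (Σ; _×_; _,_)
open import Data.Sum using (_⊎_)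
open import Data.Empty using (⊥)
open import Relation.Nullary using (¬_; Dec)
open import Relation.Binary.PropositionalEquality using (_≡_; _≢_; _≗_)

record Graph : Set₁ where
  field
    n      : ℕ
    Adj    : Fin n → Fin n → Set
    adj?   : ∀ u v → Dec (Adj u v)
    sym    : ∀ {u v} → Adj u v → Adj v u
    irrefl : ∀ {u} → ¬ Adj u u

module _ (H : Graph) where
  open Graph H

  IsWalk : (k : ℕ) → Vec (Fin n) (suc k) → Fin n → Fin n → Set
  IsWalk k p u v =
    lookup p zero ≡ u × lookup p (fromℕ k) ≡ v ×
    (∀ (i : Fin k) → Adj (lookup p (inject₁ i)) (lookup p (suc i)))

  Dist : Fin n → Fin n → ℕ → Set
  Dist u v k =
    Σ (Vec (Fin n) (suc k)) (λ p → IsWalk k p u v) ×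
    (∀ (m : ℕ) (p : Vec (Fin n) (suc m)) → IsWalk m p u v → k ≤ m)

  -- An S-path (given dist(s,t) = d): an s–t walk of length d,
  -- i.e. a shortest s–t path, listed as its vertex sequence.
  SPath : Fin n → Fin n → (d : ℕ) → Vec (Fin n) (suc d) → Set
  SPath s t d P = IsWalk d P s t

  InLayer : Fin n → Fin n → ℕ → ℕ → Fin n → Set
  InLayer s t d i v = Dist s v i × Dist t v (d ∸ i)

  OneNew : ∀ {d} → Vec (Fin n) d → Vec (Fin n) d → Set
  OneNew P Q = Σ (Fin n) λ v → v ∈ Q × v ∉ P × (∀ w → w ∈ Q → w ∉ P → w ≡ v)

  AdjSPath : ∀ {d} → Vec (Fin n) d → Vec (Fin n) d → Set
  AdjSPath P Q = OneNew P Q × OneNew Q P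

  SPathSeq : Fin n → Fin n → (d : ℕ) → Vec (Fin n) (suc d) → Vec (Fin n) (suc d) → Set
  SPathSeq s t d P P' =
    Σ ℕ λ ℓ → Σ (Fin (suc ℓ) → Vec (Fin n) (suc d)) λ Q →
      (∀ j → SPath s t d (Q j)) × Q zero ≡ P × Q (fromℕ ℓ) ≡ P' ×
      (∀ (j : Fin ℓ) → AdjSPath (Q (inject₁ j)) (Q (suc j)))

  DistinctColors : Fin n → Fin n → ℕ → {C : Set} → (ℕ → Fin n → C) → Set
  DistinctColors s t d c =
    ∀ i j v v' → 1 ≤ i → i ≤ d ∸ 1 → 1 ≤ j → j ≤ d ∸ 1 →
      InLayer s t d i v → InLayer s t d j v' → c i v ≡ c j v' → i ≡ j × v ≡ v'

-- small arithmetic facts used to build layer vertices u_i, u_{i+1}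
-- from the index of a forbidden vertex

≤∸2⇒≤∸1 : ∀ {i} d → i ≤ d ∸ 2 → i ≤ d ∸ 1
≤∸2⇒≤∸1 zero p = p
≤∸2⇒≤∸1 (suc zero) p = p
≤∸2⇒≤∸1 {zero} (suc (suc d)) p = z≤n
≤∸2⇒≤∸1 {suc i} (suc (suc zero)) ()
≤∸2⇒≤∸1 {suc i} (suc (suc (suc d))) (s≤s p) = s≤s (≤∸2⇒≤∸1 (suc (suc d)) p)

suc≤∸1 : ∀ {i} d → 1 ≤ i → i ≤ d ∸ 2 → suc i ≤ d ∸ 1
suc≤∸1 zero (s≤s z≤n) ()
suc≤∸1 (suc zero) (s≤s z≤n) ()
suc≤∸1 (suc (suc d)) _ p = s≤s p

-- The list-coloring instance (G, L) built from H, s, t, d and colors c.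
-- c i v plays the role of c_{i,j} where v = v_{i,j} ∈ Λ_i.

module Construction (H : Graph) (s t : Fin (Graph.n H)) (d : ℕ)
                    {C : Set} (c : ℕ → Fin (Graph.n H) → C) where
  open Graph H

  Λ : ℕ → Fin n → Set
  Λ i v = InLayer H s t d i v

  -- Side conditions are irrelevant, so each vertex is determined by its data.
  data GV : Set where
    u : (i : ℕ) → .(1 ≤ i) → .(i ≤ d ∸ 1) → GV
    w : (i : ℕ) (x y : Fin n) → .(1 ≤ i) → .(i ≤ d ∸ 2) →
        .(Λ i x) → .(Λ (suc i) y) → .(¬ Adj x y) → GV

  E : GV → GV → Set
  E (u j _ _) (w i _ _ _ _ _ _ _) = j ≡ i ⊎ j ≡ suc i
  E (w i _ _ _ _ _ _ _) (u j _ _) = j ≡ i ⊎ j ≡ suc i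
  E _ _ = ⊥

  L : GV → C → Set
  L (u i _ _) col = Σ (Fin n) λ v → Λ i v × c i v ≡ col
  L (w i x y _ _ _ _ _) col = col ≡ c i x ⊎ col ≡ c (suc i) y

  IsColoring : (GV → C) → Set
  IsColoring f = (∀ a → L a (f a)) × (∀ a b → E a b → f a ≢ f b)

  DiffOne : (GV → C) → (GV → C) → Set
  DiffOne f g = Σ GV λ a → f a ≢ g a × (∀ b → f b ≢ g b → b ≡ a)

  -- a path in the reconfiguration graph R(G,L) from f to g
  -- (colorings are functions, identified up to pointwise equality)
  ReconfPath : (GV → C) → (GV → C) → Set
  ReconfPath f g =
    Σ ℕ λ m → Σ (Fin (suc m) → GV → C) λ h →
      (∀ k → IsColoring (h k)) × h zero ≗ f × h (fromℕ m) ≗ g ×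
      (∀ (k : Fin m) → DiffOne (h (inject₁ k)) (h (suc k)))

  FromSPath : Vec (Fin n) (suc d) → (GV → C) → Set
  FromSPath P f =
    (∀ i (k : Fin (suc d)) → toℕ k ≡ i → (p : 1 ≤ i) (q : i ≤ d ∸ 1) →
       f (u i p q) ≡ c i (lookup P k)) ×
    (∀ i x y (p : 1 ≤ i) (q : i ≤ d ∸ 2) (lx : Λ i x) (ly : Λ (suc i) y)
       (nxy : ¬ Adj x y) →
       let a = w i x y p q lx ly nxy in
       L a (f a) ×
       f a ≢ f (u i p (≤∸2⇒≤∸1 d q)) ×
       f a ≢ f (u (suc i) (s≤s z≤n) (suc≤∸1 d p q)))

module Submission where

-- Colourings compatible with the same Q are
--    connected by recolouring forbidden vertices one at a time, and for
--    adjacent Q, Q' some colouring of the forbidden vertices suits both, so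
--    the differing u_i can be recoloured in one step.
--  * Instance, backward direction: a colouring f decodes to the S-path whose
--    i-th vertex carries the colour f(u_i) (a forbidden vertex w_{i,x,y}
--    would have no colour left if consecutive decoded vertices were
--    non-adjacent); one recolouring step moves the decoded path by at most
--    one adjacency.

open import Defs
open import Data.Nat using (ℕ; zero; suc; _+_; _∸_; _≤_; _<_; z≤n; s≤s; _≤?_)
open import Data.Nat.Properties
open import Data.Fin using (Fin; zero; suc; toℕ; fromℕ; inject₁; fromℕ<)
open import Data.Fin.Properties using (toℕ-fromℕ; toℕ-inject₁; toℕ-fromℕ<; toℕ<n; any?)
  renaming (_≟_ to _≟ᶠ_)
open import Data.Vec using (Vec; []; _∷_; lookup; tabulate)
open import Data.Vec.Properties using (lookup∘tabulate)
open import Data.Vec.Membership.Propositional using (_∈_; _∉_)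
open import Data.Vec.Relation.Unary.Any using (here; there)
open import Data.Product using (Σ; _×_; _,_; proj₁; proj₂)
open import Data.Product.Properties using (≡-dec)
open import Data.Sum using (_⊎_; inj₁; inj₂)
open import Data.Empty using (⊥-elim)
open import Data.List using (List; []; _∷_; cartesianProduct; upTo; allFin)
import Data.List.Membership.Propositional as List
open import Data.List.Membership.Propositional.Properties
  using (∈-cartesianProduct⁺; ∈-upTo⁺; ∈-allFin)
open import Data.List.Relation.Unary.Any as ListAny using ()
open import Function.Bundles using (_⇔_; mk⇔)
open import Relation.Nullary using (¬_; Dec; yes; no)
open import Relation.Nullary.Decidable using (recompute; _×-dec_; ¬?; map′)
open import Relation.Binary.PropositionalEquality

-- Reading a nonempty vector at a natural-number position.  Walks are handled
-- as functions ℕ → V(H), which avoids arithmetic on Fin.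
module _ {A : Set} where
  -- positions beyond the end read the last entry
  at : ∀ {k} → Vec A (suc k) → ℕ → A
  at (x ∷ []) _ = x
  at (x ∷ (y ∷ r)) zero = x
  at (x ∷ (y ∷ r)) (suc j) = at (y ∷ r) j

  at-lookup : ∀ {k} (p : Vec A (suc k)) (i : Fin (suc k)) → at p (toℕ i) ≡ lookup p i
  at-lookup (x ∷ []) zero = refl
  at-lookup (x ∷ (y ∷ r)) zero = refl
  at-lookup (x ∷ (y ∷ r)) (suc i) = at-lookup (y ∷ r) i

  tabulateℕ : ∀ k → (ℕ → A) → Vec A (suc k)
  tabulateℕ k f = tabulate (λ i → f (toℕ i))

  at-tabulateℕ : ∀ k (f : ℕ → A) j → j ≤ k → at (tabulateℕ k f) j ≡ f j
  at-tabulateℕ zero f zero _ = refl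
  at-tabulateℕ (suc k) f zero _ = refl
  at-tabulateℕ (suc k) f (suc j) (s≤s le) = at-tabulateℕ k (λ m → f (suc m)) j le

  at-ext : ∀ {k} (p q : Vec A (suc k)) → (∀ j → j ≤ k → at p j ≡ at q j) → p ≡ q
  at-ext (x ∷ []) (y ∷ []) e = cong (_∷ []) (e 0 z≤n)
  at-ext (x ∷ (x' ∷ r)) (y ∷ (y' ∷ r')) e =
    cong₂ _∷_ (e 0 z≤n) (at-ext (x' ∷ r) (y' ∷ r') (λ j le → e (suc j) (s≤s le)))

  at-∈ : ∀ {k} (p : Vec A (suc k)) j → j ≤ k → at p j ∈ p
  at-∈ (x ∷ []) zero _ = here refl
  at-∈ (x ∷ (y ∷ r)) zero _ = here refl
  at-∈ (x ∷ (y ∷ r)) (suc j) (s≤s le) = there (at-∈ (y ∷ r) j le)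

  ∈⇒at : ∀ {k} {x} (p : Vec A (suc k)) → x ∈ p → Σ ℕ λ j → j ≤ k × at p j ≡ x
  ∈⇒at (x ∷ []) (here e) = 0 , z≤n , sym e
  ∈⇒at (x ∷ (y ∷ r)) (here e) = 0 , z≤n , sym e
  ∈⇒at (x ∷ (y ∷ r)) (there m) with ∈⇒at (y ∷ r) m
  ... | j , le , e = suc j , s≤s le , e

module Walks (H : Graph) where
  open Graph H renaming (sym to Adj-sym)

  Walk : ℕ → Fin n → Fin n → Set
  Walk k u v = Σ (ℕ → Fin n) λ P → P 0 ≡ u × P k ≡ v × (∀ j → j < k → Adj (P j) (P (suc j)))

  fromIsWalk : ∀ {k p u v} → IsWalk H k p u v → Walk k u v
  fromIsWalk {k} {p} (e0 , ek , ad) =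
    at p , trans (at-lookup p zero) e0 ,
    trans (subst (λ z → at p z ≡ lookup p (fromℕ k)) (toℕ-fromℕ k) (at-lookup p (fromℕ k))) ek ,
    λ j j<k → let i = fromℕ< j<k in
      subst₂ Adj
        (trans (sym (at-lookup p (inject₁ i))) (cong (at p) (trans (toℕ-inject₁ i) (toℕ-fromℕ< j<k))))
        (trans (sym (at-lookup p (suc i))) (cong (at p) (cong suc (toℕ-fromℕ< j<k))))
        (ad i)

  toIsWalk : ∀ {k u v} → Walk k u v → Σ (Vec (Fin n) (suc k)) λ p → IsWalk H k p u v
  toIsWalk {k} (P , e0 , ek , ad) =
    tabulateℕ k P , trans (lookup∘tabulate (λ i → P (toℕ i)) (zero {n = k})) e0 ,
    trans (lookup∘tabulate (λ i → P (toℕ i)) (fromℕ k)) (trans (cong P (toℕ-fromℕ k)) ek) ,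
    λ i → subst₂ Adj
      (sym (trans (lookup∘tabulate (λ i → P (toℕ i)) (inject₁ i)) (cong P (toℕ-inject₁ i))))
      (sym (lookup∘tabulate (λ i → P (toℕ i)) (suc i)))
      (ad (toℕ i) (toℕ<n i))

  Distance : Fin n → Fin n → ℕ → Set
  Distance u v k = Walk k u v × (∀ m → Walk m u v → k ≤ m)

  fromDist : ∀ {u v k} → Dist H u v k → Distance u v k
  fromDist {k = k} ((p , w) , minimal) =
    fromIsWalk {k} {p} w , λ m W → minimal m (proj₁ (toIsWalk W)) (proj₂ (toIsWalk W))

  toDist : ∀ {u v k} → Distance u v k → Dist H u v k
  toDist (W , minimal) = toIsWalk W , λ m p w → minimal m (fromIsWalk {m} {p} w)

  distance-unique : ∀ {u v i j} → Distance u v i → Distance u v j → i ≡ j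
  distance-unique (Wi , mi) (Wj , mj) = ≤-antisym (mi _ Wj) (mj _ Wi)

  stay : ∀ u → Walk 0 u u
  stay u = (λ _ → u) , refl , refl , λ j ()

  Walk0⇒≡ : ∀ {u v} → Walk 0 u v → u ≡ v
  Walk0⇒≡ (P , e0 , ek , _) = trans (sym e0) ek

  cons : ∀ {k u x v} → Adj u x → Walk k x v → Walk (suc k) u v
  cons {u = u} a (P , e0 , ek , ad) =
    (λ { zero → u ; (suc j) → P j }) , refl , ek ,
    λ { zero _ → subst (Adj u) (sym e0) a ; (suc j) (s≤s lt) → ad j lt }

  uncons : ∀ {k u v} → Walk (suc k) u v → Σ (Fin n) λ x → Adj u x × Walk k x v
  uncons (P , e0 , ek , ad) =
    P 1 , subst (λ z → Adj z (P 1)) e0 (ad 0 (s≤s z≤n)) ,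
    ((λ j → P (suc j)) , refl , ek , λ j lt → ad (suc j) (s≤s lt))

  distance1⇒Adj : ∀ {u v} → Dist H u v 1 → Adj u v
  distance1⇒Adj dist with uncons (proj₁ (fromDist dist))
  ... | x , ux , W = subst (Adj _) (Walk0⇒≡ W) ux

  concat : ∀ a {b u v w} → Walk a u v → Walk b v w → Walk (a + b) u w
  concat zero W W' = subst (λ z → Walk _ z _) (sym (Walk0⇒≡ W)) W'
  concat (suc a) W W' with uncons W
  ... | x , ux , W₁ = cons ux (concat a W₁ W')

  reverse : ∀ {k u v} → Walk k u v → Walk k v u
  reverse {k} (P , e0 , ek , ad) =
    (λ j → P (k ∸ j)) , ek , trans (cong P (n∸n≡0 k)) e0 ,
    λ j lt → Adj-sym (subst (λ z → Adj (P (k ∸ suc j)) (P z)) (suc-∸ k j lt)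
                             (ad (k ∸ suc j) (∸-monoʳ-< (s≤s z≤n) lt)))
    where
    suc-∸ : ∀ k j → j < k → suc (k ∸ suc j) ≡ k ∸ j
    suc-∸ (suc k) zero _ = refl
    suc-∸ (suc k) (suc j) (s≤s lt) = suc-∸ k j lt

  prefix : ∀ {k u} (P : ℕ → Fin n) → P 0 ≡ u → (∀ j → j < k → Adj (P j) (P (suc j))) →
           ∀ j → j ≤ k → Walk j u (P j)
  prefix P e0 ad j le = P , e0 , refl , λ l lt → ad l (≤-trans lt le)

  suffix : ∀ {k v} (P : ℕ → Fin n) → P k ≡ v → (∀ j → j < k → Adj (P j) (P (suc j))) →
           ∀ j → j ≤ k → Walk (k ∸ j) (P j) v
  suffix {k} P ek ad j le =
    (λ l → P (j + l)) , cong P (+-identityʳ j) , trans (cong P (m+[n∸m]≡n le)) ek ,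
    λ l lt → subst (λ z → Adj (P (j + l)) (P z)) (sym (+-suc j l))
               (ad (j + l) (subst (λ z → j + l < z) (m+[n∸m]≡n le) (+-monoʳ-< j lt)))

  walk? : ∀ k u v → Dec (Walk k u v)
  walk? zero u v with u ≟ᶠ v
  ... | yes refl = yes (stay u)
  ... | no u≢v = no λ W → u≢v (Walk0⇒≡ W)
  walk? (suc k) u v with any? (λ x → adj? u x ×-dec walk? k x v)
  ... | yes (x , ux , W) = yes (cons ux W)
  ... | no none = no λ W → none (uncons W)

  dist? : ∀ u v k → Dec (Dist H u v k)
  dist? u v k = map′ toDist fromDist distance?
    where
    distance? : Dec (Distance u v k)
    distance? with walk? k u v | allUpTo? (λ m → ¬? (walk? m u v)) k
    ... | yes W | yes none = yes (W , λ m W' → ≮⇒≥ λ lt → none lt W')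
    ... | yes W | no some = no λ { (_ , minimal) → some λ lt W' → <⇒≱ lt (minimal _ W') }
    ... | no ¬W | _ = no λ { (W , _) → ¬W W }

module ShortestPaths (H : Graph) (s t : Fin (Graph.n H)) (d : ℕ) (dst : Dist H s t d) where
  open Graph H using (n; Adj)
  open Walks H

  IsShortest : (ℕ → Fin n) → Set
  IsShortest P = P 0 ≡ s × P d ≡ t × (∀ j → j < d → Adj (P j) (P (suc j)))

  -- position j of a shortest path lies in the layer Λ_j: a shorter walk to or
  -- from P j would combine with the rest of P into an s–t walk shorter than d
  shortest-layer : ∀ {P} → IsShortest P → ∀ j → j ≤ d →
                   Distance s (P j) j × Distance t (P j) (d ∸ j)
  shortest-layer {P} (e0 , ed , ad) j le =
    (prefix P e0 ad j le , λ m W → +-cancelʳ-≤ (d ∸ j) j m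
        (subst (λ z → z ≤ m + (d ∸ j)) (sym (m+[n∸m]≡n le))
           (minimal _ (concat m W (suffix P ed ad j le))))) ,
    (reverse (suffix P ed ad j le) , λ m W → m≤n+o⇒m∸n≤o d j
        (minimal _ (concat j (prefix P e0 ad j le) (reverse W))))
    where minimal = proj₂ (fromDist dst)

  shortest-InLayer : ∀ {P} → IsShortest P → ∀ j → j ≤ d → InLayer H s t d j (P j)
  shortest-InLayer sp j le =
    toDist (proj₁ (shortest-layer sp j le)) , toDist (proj₂ (shortest-layer sp j le))

  Path : Set
  Path = Vec (Fin n) (suc d)

  SPath⇒IsShortest : ∀ {P : Path} → SPath H s t d P → IsShortest (at P)
  SPath⇒IsShortest {P} w = proj₂ (fromIsWalk {d} {P} w)

  position-unique : ∀ {P Q : Path} → SPath H s t d P → SPath H s t d Q → ∀ {i j} → i ≤ d → j ≤ d →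
                    at P i ≡ at Q j → i ≡ j
  position-unique {P} {Q} wp wq {i} {j} li lj e =
    distance-unique (subst (λ z → Distance s z i) e (proj₁ (shortest-layer (SPath⇒IsShortest {P} wp) i li)))
                    (proj₁ (shortest-layer (SPath⇒IsShortest {Q} wq) j lj))

  differ⇒∉ : ∀ {Q Q' : Path} → SPath H s t d Q → SPath H s t d Q' → ∀ j → j ≤ d →
             at Q j ≢ at Q' j → at Q' j ∉ Q
  differ⇒∉ {Q} {Q'} wq wq' j j≤d differ mem with ∈⇒at Q mem
  ... | i , i≤d , e = differ (subst (λ z → at Q z ≡ at Q' j) (position-unique {Q} {Q'} wq wq' i≤d j≤d e) e)

  DifferOnlyAt : (ℕ → Fin n) → (ℕ → Fin n) → ℕ → Set
  DifferOnlyAt Q Q' i₀ = Q i₀ ≢ Q' i₀ × (∀ j → j ≤ d → j ≢ i₀ → Q j ≡ Q' j)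

  -- if Q' has only one vertex outside Q, then Q and Q' differ at exactly one
  -- position, which is interior since both paths start at s and end at t
  OneNew⇒DifferOnlyAt : ∀ {Q Q' : Path} → SPath H s t d Q → SPath H s t d Q' → OneNew H Q Q' →
                        Σ ℕ λ i₀ → 1 ≤ i₀ × i₀ ≤ d ∸ 1 × DifferOnlyAt (at Q) (at Q') i₀
  OneNew⇒DifferOnlyAt {Q} {Q'} wq wq' (v , v∈Q' , v∉Q , onlyNew) with ∈⇒at Q' v∈Q'
  ... | m , m≤d , em = m , 1≤m , <⇒≤pred m<d , differ , agree
    where
    spQ = SPath⇒IsShortest {Q} wq
    spQ' = SPath⇒IsShortest {Q'} wq'
    differ : at Q m ≢ at Q' m
    differ e = v∉Q (subst (_∈ Q) (trans e em) (at-∈ Q m m≤d))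
    1≤m : 1 ≤ m
    1≤m = n≢0⇒n>0 λ { refl → differ (trans (proj₁ spQ) (sym (proj₁ spQ'))) }
    m<d : m < d
    m<d = ≤∧≢⇒< m≤d λ { refl → differ (trans (proj₁ (proj₂ spQ)) (sym (proj₁ (proj₂ spQ')))) }
    agree : ∀ j → j ≤ d → j ≢ m → at Q j ≡ at Q' j
    agree j j≤d j≢m with at Q j ≟ᶠ at Q' j
    ... | yes e = e
    ... | no nj = ⊥-elim (j≢m (position-unique {Q'} {Q'} wq' wq' j≤d m≤d
                    (trans (onlyNew (at Q' j) (at-∈ Q' j j≤d) (differ⇒∉ {Q} {Q'} wq wq' j j≤d nj)) (sym em))))

  DifferOnlyAt⇒OneNew : ∀ {Q Q' : Path} → SPath H s t d Q → SPath H s t d Q' → ∀ {i₀} → i₀ ≤ d →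
                        DifferOnlyAt (at Q) (at Q') i₀ → OneNew H Q Q'
  DifferOnlyAt⇒OneNew {Q} {Q'} wq wq' {i₀} i₀≤d (differ , agree) =
    at Q' i₀ , at-∈ Q' i₀ i₀≤d , differ⇒∉ {Q} {Q'} wq wq' i₀ i₀≤d differ , onlyNew
    where
    onlyNew : ∀ x → x ∈ Q' → x ∉ Q → x ≡ at Q' i₀
    onlyNew x x∈Q' x∉Q with ∈⇒at Q' x∈Q'
    ... | m , m≤d , em with m ≟ i₀
    ...   | yes refl = sym em
    ...   | no m≢i₀ = ⊥-elim (x∉Q (subst (_∈ Q) (trans (agree m m≤d m≢i₀) em) (at-∈ Q m m≤d)))

  DifferOnlyAt⇒Adjacent : ∀ {Q Q' : Path} → SPath H s t d Q → SPath H s t d Q' → ∀ {i₀} → i₀ ≤ d →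
                          DifferOnlyAt (at Q) (at Q') i₀ → AdjSPath H Q Q'
  DifferOnlyAt⇒Adjacent {Q} {Q'} wq wq' le (differ , agree) =
    DifferOnlyAt⇒OneNew {Q} {Q'} wq wq' le (differ , agree) ,
    DifferOnlyAt⇒OneNew {Q'} {Q} wq' wq le ((λ e → differ (sym e)) , λ j l nj → sym (agree j l nj))

  equal-or-adjacent : ∀ {Q Q' : Path} → SPath H s t d Q → SPath H s t d Q' → ∀ {k} → k ≤ d →
                      (∀ j → j ≤ d → at Q j ≢ at Q' j → j ≡ k) → Q ≡ Q' ⊎ AdjSPath H Q Q'
  equal-or-adjacent {Q} {Q'} wq wq' {k} k≤d only with at Q k ≟ᶠ at Q' k
  ... | yes same = inj₁ (at-ext Q Q' agree)
    where
    agree : ∀ j → j ≤ d → at Q j ≡ at Q' j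
    agree j le with at Q j ≟ᶠ at Q' j
    ... | yes e = e
    ... | no ne = ⊥-elim (ne (subst (λ z → at Q z ≡ at Q' z) (sym (only j le ne)) same))
  ... | no differ = inj₂ (DifferOnlyAt⇒Adjacent {Q} {Q'} wq wq' k≤d (differ , agree))
    where
    agree : ∀ j → j ≤ d → j ≢ k → at Q j ≡ at Q' j
    agree j le j≢k with at Q j ≟ᶠ at Q' j
    ... | yes e = e
    ... | no ne = ⊥-elim (j≢k (only j le ne))

  data SPathChain : Path → Path → Set where
    [_] : ∀ {P} → SPath H s t d P → SPathChain P P
    _∷⟨_⟩_ : ∀ {P Q R} → SPath H s t d P → AdjSPath H P Q → SPathChain Q R → SPathChain P R

  SPathChain-head : ∀ {P R} → SPathChain P R → SPath H s t d P
  SPathChain-head [ w ] = w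
  SPathChain-head (w ∷⟨ _ ⟩ _) = w

  SPathSeq⇒SPathChain : ∀ {P P'} → SPathSeq H s t d P P' → SPathChain P P'
  SPathSeq⇒SPathChain (ℓ , Q , ws , e0 , eℓ , adj) = subst₂ SPathChain e0 eℓ (go ℓ Q ws adj)
    where
    go : ∀ ℓ (Q : Fin (suc ℓ) → Path) → (∀ j → SPath H s t d (Q j)) →
         (∀ (j : Fin ℓ) → AdjSPath H (Q (inject₁ j)) (Q (suc j))) → SPathChain (Q zero) (Q (fromℕ ℓ))
    go zero Q ws adj = [ ws zero ]
    go (suc ℓ) Q ws adj = ws zero ∷⟨ adj zero ⟩ go ℓ (λ j → Q (suc j)) (λ j → ws (suc j)) (λ j → adj (suc j))

  SPathChain⇒SPathSeq : ∀ {P P'} → SPathChain P P' → SPathSeq H s t d P P'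
  SPathChain⇒SPathSeq {P} [ w ] = 0 , (λ _ → P) , (λ _ → w) , refl , refl , λ ()
  SPathChain⇒SPathSeq {P} (w ∷⟨ a ⟩ rest) with SPathChain⇒SPathSeq rest
  ... | ℓ , Q , ws , e0 , eℓ , adj = suc ℓ , Q' , ws' , refl , eℓ , adj'
    where
    Q' : Fin (suc (suc ℓ)) → Path
    Q' zero = P
    Q' (suc j) = Q j
    ws' : ∀ j → SPath H s t d (Q' j)
    ws' zero = w
    ws' (suc j) = ws j
    adj' : ∀ (j : Fin (suc ℓ)) → AdjSPath H (Q' (inject₁ j)) (Q' (suc j))
    adj' zero = subst (AdjSPath H P) (sym e0) a
    adj' (suc j) = adj j

module Reconfiguration (H : Graph) (s t : Fin (Graph.n H)) (d : ℕ)
                       {C : Set} (c : ℕ → Fin (Graph.n H) → C) where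
  open Construction H s t d c

  data Reconf : (GV → C) → (GV → C) → Set where
    stop : ∀ {f g} → IsColoring f → f ≗ g → Reconf f g
    move : ∀ {f g h} → IsColoring f → DiffOne f g → Reconf g h → Reconf f h

  IsColoring-resp : ∀ {f g} → f ≗ g → IsColoring g → IsColoring f
  IsColoring-resp e (inList , proper) =
    (λ a → subst (L a) (sym (e a)) (inList a)) ,
    λ a b ab eq → proper a b ab (trans (sym (e a)) (trans eq (e b)))

  DiffOne-respˡ : ∀ {f f' g} → f ≗ f' → DiffOne f' g → DiffOne f g
  DiffOne-respˡ e (a , ne , only) =
    a , (λ x → ne (trans (sym (e a)) x)) , λ b nb → only b (λ x → nb (trans (e b) x))

  DiffOne-respʳ : ∀ {f g g'} → g ≗ g' → DiffOne f g → DiffOne f g'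
  DiffOne-respʳ e (a , ne , only) =
    a , (λ x → ne (trans x (sym (e a)))) , λ b nb → only b (λ x → nb (trans x (e b)))

  Reconf-respˡ : ∀ {f f' g} → f ≗ f' → Reconf f' g → Reconf f g
  Reconf-respˡ e (stop col e') = stop (IsColoring-resp e col) (λ a → trans (e a) (e' a))
  Reconf-respˡ e (move col step rest) = move (IsColoring-resp e col) (DiffOne-respˡ e step) rest

  Reconf-respʳ : ∀ {f g g'} → Reconf f g → g ≗ g' → Reconf f g'
  Reconf-respʳ (stop col e') e = stop col (λ a → trans (e' a) (e a))
  Reconf-respʳ (move col step rest) e = move col step (Reconf-respʳ rest e)

  _++_ : ∀ {f g h} → Reconf f g → Reconf g h → Reconf f h
  stop _ e ++ rest = Reconf-respˡ e rest
  move col step rest ++ rest' = move col step (rest ++ rest')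

  infixr 5 _++_

  Reconf⇒ReconfPath : ∀ {f g} → Reconf f g → ReconfPath f g
  Reconf⇒ReconfPath {f} (stop col e) = 0 , (λ _ → f) , (λ _ → col) , (λ _ → refl) , e , λ ()
  Reconf⇒ReconfPath {f} (move col step rest) with Reconf⇒ReconfPath rest
  ... | m , h , cols , e0 , em , steps = suc m , h' , cols' , (λ _ → refl) , em , steps'
    where
    h' : Fin (suc (suc m)) → GV → C
    h' zero = f
    h' (suc k) = h k
    cols' : ∀ k → IsColoring (h' k)
    cols' zero = col
    cols' (suc k) = cols k
    steps' : ∀ (k : Fin (suc m)) → DiffOne (h' (inject₁ k)) (h' (suc k))
    steps' zero = DiffOne-respʳ (λ a → sym (e0 a)) step
    steps' (suc k) = steps k

  ReconfPath⇒Reconf : ∀ {f g} → ReconfPath f g → Reconf f g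
  ReconfPath⇒Reconf (m , h , cols , e0 , em , steps) =
    Reconf-respʳ (Reconf-respˡ (λ a → sym (e0 a)) (go m h cols steps)) em
    where
    go : ∀ m (h : Fin (suc m) → GV → C) → (∀ k → IsColoring (h k)) →
         (∀ (k : Fin m) → DiffOne (h (inject₁ k)) (h (suc k))) → Reconf (h zero) (h (fromℕ m))
    go zero h cols steps = stop (cols zero) (λ _ → refl)
    go (suc m) h cols steps =
      move (cols zero) (steps zero) (go m (λ k → h (suc k)) (λ k → cols (suc k)) (λ k → steps (suc k)))

module Instance (H : Graph) (s t : Fin (Graph.n H)) (d : ℕ) (dst : Dist H s t d)
                {C : Set} (c : ℕ → Fin (Graph.n H) → C) (distinct : DistinctColors H s t d c) where
  open Graph H using (n; Adj; adj?) renaming (sym to Adj-sym)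
  open Walks H
  open ShortestPaths H s t d dst
  open Construction H s t d c
  open Reconfiguration H s t d c

  -- The side conditions stored in vertices of G are irrelevant; being
  -- decidable, they can be recovered when a proof of them is needed.
  recompute-≤ : ∀ {i k} → .(i ≤ k) → i ≤ k
  recompute-≤ {i} {k} = recompute (i ≤? k)

  Λ? : ∀ i v → Dec (Λ i v)
  Λ? i v = dist? s v i ×-dec dist? t v (d ∸ i)

  recompute-Λ : ∀ {i v} → .(Λ i v) → Λ i v
  recompute-Λ {i} {v} = recompute (Λ? i v)

  recompute-¬Adj : ∀ {x y} → .(¬ Adj x y) → ¬ Adj x y
  recompute-¬Adj {x} {y} = recompute (¬? (adj? x y))

  interior⇒≤ : ∀ {i} → i ≤ d ∸ 1 → i ≤ d
  interior⇒≤ q = ≤-trans q pred[n]≤n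

  c-injective : ∀ {i v v'} → 1 ≤ i → i ≤ d ∸ 1 → Λ i v → Λ i v' → c i v ≡ c i v' → v ≡ v'
  c-injective p q l l' e = proj₂ (distinct _ _ _ _ p q p q l l' e)

  c-next-layer : ∀ {i v v'} → 1 ≤ i → i ≤ d ∸ 2 → Λ i v → Λ (suc i) v' → c i v ≢ c (suc i) v'
  c-next-layer p q l l' e =
    1+n≢n (sym (proj₁ (distinct _ _ _ _ p (≤∸2⇒≤∸1 d q) (s≤s z≤n) (suc≤∸1 d p q) l l' e)))

  Avoids : (ℕ → Fin n) → ℕ → Fin n → Fin n → C → Set
  Avoids Q i x y col = (col ≡ c i x ⊎ col ≡ c (suc i) y) × col ≢ c i (Q i) × col ≢ c (suc i) (Q (suc i))

  Compatible : (ℕ → Fin n) → (GV → C) → Set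
  Compatible Q f =
    (∀ i .(p : 1 ≤ i) .(q : i ≤ d ∸ 1) → f (u i p q) ≡ c i (Q i)) ×
    (∀ i x y .(p : 1 ≤ i) .(q : i ≤ d ∸ 2) .(lx : Λ i x) .(ly : Λ (suc i) y) .(nxy : ¬ Adj x y) →
       Avoids Q i x y (f (w i x y p q lx ly nxy)))

  Compatible⇒IsColoring : ∀ {Q f} → IsShortest Q → Compatible Q f → IsColoring f
  Compatible⇒IsColoring {Q} {f} sp (onU , onW) = inList , proper
    where
    inList : ∀ a → L a (f a)
    inList (u i p q) = Q i , shortest-InLayer sp i (interior⇒≤ (recompute-≤ q)) , sym (onU i p q)
    inList (w i x y p q lx ly nxy) = proj₁ (onW i x y p q lx ly nxy)
    avoidsᵘ : ∀ i x y .p .q .lx .ly .nxy j .p' .q' → j ≡ i ⊎ j ≡ suc i →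
              f (u j p' q') ≢ f (w i x y p q lx ly nxy)
    avoidsᵘ i x y p q lx ly nxy j p' q' (inj₁ refl) e =
      proj₁ (proj₂ (onW i x y p q lx ly nxy)) (trans (sym e) (onU i _ _))
    avoidsᵘ i x y p q lx ly nxy j p' q' (inj₂ refl) e =
      proj₂ (proj₂ (onW i x y p q lx ly nxy)) (trans (sym e) (onU (suc i) _ _))
    proper : ∀ a b → E a b → f a ≢ f b
    proper (u j _ _) (w i x y p q lx ly nxy) ab e = avoidsᵘ i x y p q lx ly nxy j _ _ ab e
    proper (w i x y p q lx ly nxy) (u j _ _) ab e = avoidsᵘ i x y p q lx ly nxy j _ _ ab (sym e)

  -- Recolouring forbidden vertices.  A forbidden vertex w_{i,x,y} is
  -- determined by its tag (i, x, y).
  Tag : Set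
  Tag = ℕ × Fin n × Fin n

  _≟ᵗ_ : (a b : Tag) → Dec (a ≡ b)
  _≟ᵗ_ = ≡-dec _≟_ (≡-dec _≟ᶠ_ _≟ᶠ_)

  override : Tag → (GV → C) → (GV → C) → GV → C
  override τ f g (u i p q) = f (u i p q)
  override τ f g (w i x y p q lx ly nxy) with (i , x , y) ≟ᵗ τ
  ... | yes _ = g (w i x y p q lx ly nxy)
  ... | no _ = f (w i x y p q lx ly nxy)

  -- equality is decidable between colours from the list {c_{i,x}, c_{i+1,y}},
  -- although it need not be decidable on C
  list-colours-decide : ∀ {i x y α β} → 1 ≤ i → i ≤ d ∸ 2 → Λ i x → Λ (suc i) y →
                        (α ≡ c i x ⊎ α ≡ c (suc i) y) → (β ≡ c i x ⊎ β ≡ c (suc i) y) → α ≡ β ⊎ α ≢ β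
  list-colours-decide p q lx ly (inj₁ e₁) (inj₁ e₂) = inj₁ (trans e₁ (sym e₂))
  list-colours-decide p q lx ly (inj₂ e₁) (inj₂ e₂) = inj₁ (trans e₁ (sym e₂))
  list-colours-decide p q lx ly (inj₁ e₁) (inj₂ e₂) =
    inj₂ λ e → c-next-layer p q lx ly (trans (sym e₁) (trans e e₂))
  list-colours-decide p q lx ly (inj₂ e₁) (inj₁ e₂) =
    inj₂ λ e → c-next-layer p q lx ly (sym (trans (sym e₁) (trans e e₂)))

  module _ {Q : ℕ → Fin n} {f g : GV → C} (fQ : Compatible Q f) (gQ : Compatible Q g) where
    override-compatible : ∀ τ → Compatible Q (override τ f g)
    override-compatible τ = proj₁ fQ , onW
      where
      onW : ∀ i x y .(p : 1 ≤ i) .(q : i ≤ d ∸ 2) .(lx : Λ i x) .(ly : Λ (suc i) y) .(nxy : ¬ Adj x y) →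
            Avoids Q i x y (override τ f g (w i x y p q lx ly nxy))
      onW i x y p q lx ly nxy with (i , x , y) ≟ᵗ τ
      ... | yes _ = proj₂ gQ i x y p q lx ly nxy
      ... | no _ = proj₂ fQ i x y p q lx ly nxy

    override-step : ∀ τ → (f ≗ override τ f g) ⊎ DiffOne f (override τ f g)
    override-step τ@(i₀ , x₀ , y₀)
      with (1 ≤? i₀) ×-dec ((i₀ ≤? d ∸ 2) ×-dec (Λ? i₀ x₀ ×-dec (Λ? (suc i₀) y₀ ×-dec ¬? (adj? x₀ y₀))))
    ... | no noVertex = inj₁ unchanged
      where
      unchanged : f ≗ override τ f g
      unchanged (u i p q) = refl
      unchanged (w i x y p q lx ly nxy) with (i , x , y) ≟ᵗ τ
      ... | no _ = refl
      ... | yes refl = ⊥-elim (noVertex (recompute-≤ p , recompute-≤ q , recompute-Λ lx ,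
                                         recompute-Λ ly , recompute-¬Adj nxy))
    ... | yes (p , q , lx , ly , nxy) =
      decide (list-colours-decide p q lx ly (proj₁ (proj₂ fQ i₀ x₀ y₀ p q lx ly nxy))
                                           (proj₁ (proj₂ gQ i₀ x₀ y₀ p q lx ly nxy)))
      where
      a = w i₀ x₀ y₀ p q lx ly nxy
      elsewhere : ∀ b → f b ≢ override τ f g b → b ≡ a
      elsewhere (u i _ _) nb = ⊥-elim (nb refl)
      elsewhere (w i x y _ _ _ _ _) nb with (i , x , y) ≟ᵗ τ
      ... | no _ = ⊥-elim (nb refl)
      ... | yes refl = refl
      at-a : override τ f g a ≡ g a
      at-a with τ ≟ᵗ τ
      ... | yes _ = refl
      ... | no τ≢τ = ⊥-elim (τ≢τ refl)
      unchanged : f a ≡ g a → f ≗ override τ f g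
      unchanged same (u i _ _) = refl
      unchanged same (w i x y _ _ _ _ _) with (i , x , y) ≟ᵗ τ
      ... | no _ = refl
      ... | yes refl = same
      decide : f a ≡ g a ⊎ f a ≢ g a → (f ≗ override τ f g) ⊎ DiffOne f (override τ f g)
      decide (inj₁ same) = inj₁ (unchanged same)
      decide (inj₂ differ) = inj₂ (a , (λ e → differ (trans e at-a)) , elsewhere)

  AgreeOutside : List Tag → (GV → C) → (GV → C) → Set
  AgreeOutside S f g =
    ∀ i x y .(p : 1 ≤ i) .(q : i ≤ d ∸ 2) .(lx : Λ i x) .(ly : Λ (suc i) y) .(nxy : ¬ Adj x y) →
      ¬ ((i , x , y) List.∈ S) → f (w i x y p q lx ly nxy) ≡ g (w i x y p q lx ly nxy)

  recolour : ∀ {Q g} → IsShortest Q → Compatible Q g →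
             ∀ S f → Compatible Q f → AgreeOutside S f g → Reconf f g
  recolour {Q} {g} sp gQ [] f fQ agree = stop (Compatible⇒IsColoring sp fQ) same
    where
    same : f ≗ g
    same (u i p q) = trans (proj₁ fQ i p q) (sym (proj₁ gQ i p q))
    same (w i x y p q lx ly nxy) = agree i x y p q lx ly nxy (λ ())
  recolour {Q} {g} sp gQ (τ ∷ S) f fQ agree = continue (override-step fQ gQ τ)
    where
    agree' : AgreeOutside S (override τ f g) g
    agree' i x y p q lx ly nxy ∉S with (i , x , y) ≟ᵗ τ
    ... | yes _ = refl
    ... | no ≢τ = agree i x y p q lx ly nxy λ { (ListAny.here e) → ≢τ e ; (ListAny.there m) → ∉S m }
    rest : Reconf (override τ f g) g
    rest = recolour sp gQ S (override τ f g) (override-compatible fQ gQ τ) agree'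
    continue : (f ≗ override τ f g) ⊎ DiffOne f (override τ f g) → Reconf f g
    continue (inj₁ e) = Reconf-respˡ e rest
    continue (inj₂ step) = move (Compatible⇒IsColoring sp fQ) step rest

  compatible-connected : ∀ {Q f g} → IsShortest Q → Compatible Q f → Compatible Q g → Reconf f g
  compatible-connected sp fQ gQ = recolour sp gQ allTags _ fQ λ i x y p q _ _ _ ∉all →
    ⊥-elim (∉all (∈-cartesianProduct⁺
                   (∈-upTo⁺ (interior⇒≤ (suc≤∸1 d (recompute-≤ p) (recompute-≤ q))))
                   (∈-cartesianProduct⁺ (∈-allFin x) (∈-allFin y))))
    where
    allTags : List Tag
    allTags = cartesianProduct (upTo d) (cartesianProduct (allFin n) (allFin n))

  Close : (ℕ → Fin n) → (ℕ → Fin n) → Set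
  Close Q Q' = ∀ j → j < d → Q' j ≡ Q j ⊎ Q' (suc j) ≡ Q (suc j)

  Close-refl : ∀ Q → Close Q Q
  Close-refl Q j _ = inj₁ refl

  Close-sym : ∀ {Q Q'} → Close Q Q' → Close Q' Q
  Close-sym close j lt with close j lt
  ... | inj₁ e = inj₁ (sym e)
  ... | inj₂ e = inj₂ (sym e)

  DifferOnlyAt⇒Close : ∀ {Q Q' i₀} → DifferOnlyAt Q Q' i₀ → Close Q Q'
  DifferOnlyAt⇒Close {i₀ = i₀} (_ , agree) j lt with j ≟ i₀
  ... | yes refl = inj₂ (sym (agree (suc j) lt (λ e → 1+n≢n e)))
  ... | no j≢i₀ = inj₁ (sym (agree j (<⇒≤ lt) j≢i₀))

  -- a colour for w_{i,x,y} avoiding the colours of u_i, u_{i+1} along both Q and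
  -- Q': c_{i+1,y} when x lies on Q or Q' at position i, and c_{i,x} otherwise
  bridgeColour : (Q Q' : ℕ → Fin n) → ℕ → Fin n → Fin n → C
  bridgeColour Q Q' i x y with x ≟ᶠ Q i | x ≟ᶠ Q' i
  ... | no _ | no _ = c i x
  ... | _ | _ = c (suc i) y

  bridgeColour-sym : ∀ Q Q' i x y → bridgeColour Q Q' i x y ≡ bridgeColour Q' Q i x y
  bridgeColour-sym Q Q' i x y with x ≟ᶠ Q i | x ≟ᶠ Q' i
  ... | yes _ | yes _ = refl
  ... | yes _ | no _ = refl
  ... | no _ | yes _ = refl
  ... | no _ | no _ = refl

  canonical : (Q Q' : ℕ → Fin n) → GV → C
  canonical Q Q' (u i _ _) = c i (Q i)
  canonical Q Q' (w i x y _ _ _ _ _) = bridgeColour Q Q' i x y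

  canonical-compatible : ∀ {Q Q'} → IsShortest Q → IsShortest Q' → Close Q Q' →
                         Compatible Q (canonical Q Q')
  canonical-compatible {Q} {Q'} sp sp' close = (λ i p q → refl) , λ i x y p q lx ly nxy →
    avoids i x y (recompute-≤ p) (recompute-≤ q) (recompute-Λ lx) (recompute-Λ ly) (recompute-¬Adj nxy)
    where
    Q-adj = proj₂ (proj₂ sp)
    Q'-adj = proj₂ (proj₂ sp')
    onQ : ∀ {i} → 1 ≤ i → i ≤ d ∸ 2 → Λ i (Q i) × Λ (suc i) (Q (suc i))
    onQ p q = shortest-InLayer sp _ (interior⇒≤ (≤∸2⇒≤∸1 d q)) ,
              shortest-InLayer sp _ (interior⇒≤ (suc≤∸1 d p q))
    next≢ : ∀ {i y} → 1 ≤ i → i ≤ d ∸ 2 → Λ (suc i) y → c (suc i) y ≢ c i (Q i)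
    next≢ p q ly e = c-next-layer p q (proj₁ (onQ p q)) ly (sym e)
    onQ-next : ∀ {i y} → 1 ≤ i → i ≤ d ∸ 2 → Λ (suc i) y → c (suc i) y ≡ c (suc i) (Q (suc i)) → y ≡ Q (suc i)
    onQ-next p q ly = c-injective (s≤s z≤n) (suc≤∸1 d p q) ly (proj₂ (onQ p q))
    avoids : ∀ i x y → 1 ≤ i → i ≤ d ∸ 2 → Λ i x → Λ (suc i) y → ¬ Adj x y →
             Avoids Q i x y (bridgeColour Q Q' i x y)
    avoids i x y p q lx ly nxy with x ≟ᶠ Q i | x ≟ᶠ Q' i
    ... | no x≢Qi | no _ =
      inj₁ refl , (λ e → x≢Qi (c-injective p (≤∸2⇒≤∸1 d q) lx (proj₁ (onQ p q)) e)) ,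
      c-next-layer p q lx (proj₂ (onQ p q))
    ... | yes refl | _ =
      inj₂ refl , next≢ p q ly ,
      λ e → nxy (subst (Adj x) (sym (onQ-next p q ly e)) (Q-adj i (interior⇒≤ (suc≤∸1 d p q))))
    ... | no x≢Qi | yes refl = inj₂ refl , next≢ p q ly , λ e → viaQ' (onQ-next p q ly e)
      where
      -- by closeness, Q' agrees with Q at i + 1, where y would then lie on Q'
      viaQ' : y ≢ Q (suc i)
      viaQ' y≡ with close i (interior⇒≤ (suc≤∸1 d p q))
      ... | inj₁ e = x≢Qi e
      ... | inj₂ e = nxy (subst (Adj (Q' i)) (trans e (sym y≡)) (Q'-adj i (interior⇒≤ (suc≤∸1 d p q))))

  -- one move along adjacent S-paths: canonical Q Q ~ canonical Q Q' (both
  -- compatible with Q), then u_{i₀} is recoloured, giving canonical Q' Q, and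
  -- canonical Q' Q ~ canonical Q' Q' (both compatible with Q')
  adjacent-step : ∀ {Q Q' i₀} → IsShortest Q → IsShortest Q' → 1 ≤ i₀ → i₀ ≤ d ∸ 1 →
                  DifferOnlyAt Q Q' i₀ → Reconf (canonical Q Q) (canonical Q' Q')
  adjacent-step {Q} {Q'} {i₀} sp sp' p q (differ , agree) =
    compatible-connected sp (canonical-compatible sp sp (Close-refl Q)) (canonical-compatible sp sp' close) ++
    move (Compatible⇒IsColoring sp (canonical-compatible sp sp' close)) recolour-u
      (compatible-connected sp' (canonical-compatible sp' sp (Close-sym close))
                                (canonical-compatible sp' sp' (Close-refl Q')))
    where
    close = DifferOnlyAt⇒Close (differ , agree)
    recolour-u : DiffOne (canonical Q Q') (canonical Q' Q)
    recolour-u = u i₀ p q ,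
      (λ e → differ (c-injective p q (shortest-InLayer sp i₀ (interior⇒≤ q))
                                     (shortest-InLayer sp' i₀ (interior⇒≤ q)) e)) ,
      only
      where
      only : ∀ b → canonical Q Q' b ≢ canonical Q' Q b → b ≡ u i₀ p q
      only (u j _ q') nb with j ≟ i₀
      ... | yes refl = refl
      ... | no j≢i₀ = ⊥-elim (nb (cong (c j) (agree j (interior⇒≤ (recompute-≤ q')) j≢i₀)))
      only (w i x y _ _ _ _ _) nb = ⊥-elim (nb (bridgeColour-sym Q Q' i x y))

  SPathChain⇒Reconf : ∀ {P P'} → SPathChain P P' → Reconf (canonical (at P) (at P)) (canonical (at P') (at P'))
  SPathChain⇒Reconf {P} [ wp ] =
    stop (Compatible⇒IsColoring sp (canonical-compatible sp sp (Close-refl _))) (λ _ → refl)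
    where sp = SPath⇒IsShortest {P} wp
  SPathChain⇒Reconf {P} (_∷⟨_⟩_ {Q = Q} wp adj rest) with OneNew⇒DifferOnlyAt {P} {Q} wp wq (proj₁ adj)
    where wq = SPathChain-head rest
  ... | i₀ , p , q , differ =
    adjacent-step (SPath⇒IsShortest {P} wp) (SPath⇒IsShortest {Q} (SPathChain-head rest)) p q differ ++
    SPathChain⇒Reconf rest

  FromSPath⇒Compatible : ∀ {P : Path} {f} → SPath H s t d P → FromSPath P f → Compatible (at P) f
  FromSPath⇒Compatible {P} {f} wp (onU , onW) = onU' , onW'
    where
    onU' : ∀ i .(p : 1 ≤ i) .(q : i ≤ d ∸ 1) → f (u i p q) ≡ c i (at P i)
    onU' i p q = trans (onU i k (toℕ-fromℕ< lt) (recompute-≤ p) (recompute-≤ q))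
                       (cong (c i) (trans (sym (at-lookup P k)) (cong (at P) (toℕ-fromℕ< lt))))
      where lt = s≤s (interior⇒≤ (recompute-≤ q)) ; k = fromℕ< lt
    onW' : ∀ i x y .(p : 1 ≤ i) .(q : i ≤ d ∸ 2) .(lx : Λ i x) .(ly : Λ (suc i) y) .(nxy : ¬ Adj x y) →
           Avoids (at P) i x y (f (w i x y p q lx ly nxy))
    onW' i x y p q lx ly nxy
      with onW i x y (recompute-≤ p) (recompute-≤ q) (recompute-Λ lx) (recompute-Λ ly) (recompute-¬Adj nxy)
    ... | inList , ≢u , ≢u' =
      inList , (λ e → ≢u (trans e (sym (onU' i p (≤∸2⇒≤∸1 d (recompute-≤ q)))))) ,
               (λ e → ≢u' (trans e (sym (onU' (suc i) (s≤s z≤n) (suc≤∸1 d (recompute-≤ p) (recompute-≤ q))))))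

  forward : ∀ {P₀ Pᵣ : Path} {f₀ fᵣ} → SPath H s t d P₀ → SPath H s t d Pᵣ →
            FromSPath P₀ f₀ → FromSPath Pᵣ fᵣ → SPathSeq H s t d P₀ Pᵣ → ReconfPath f₀ fᵣ
  forward {P₀} {Pᵣ} {f₀} {fᵣ} w₀ wᵣ from₀ fromᵣ seq = Reconf⇒ReconfPath
    (compatible-connected sp₀ (FromSPath⇒Compatible {P₀} {f₀} w₀ from₀) (canonical-compatible sp₀ sp₀ (Close-refl _)) ++
     SPathChain⇒Reconf (SPathSeq⇒SPathChain seq) ++
     compatible-connected spᵣ (canonical-compatible spᵣ spᵣ (Close-refl _)) (FromSPath⇒Compatible {Pᵣ} {fᵣ} wᵣ fromᵣ))
    where
    sp₀ = SPath⇒IsShortest {P₀} w₀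
    spᵣ = SPath⇒IsShortest {Pᵣ} wᵣ

  -- The defining property of forbidden vertices: in a
  -- list colouring, if u_i and u_{i+1} have the colours of x ∈ Λ_i and
  -- y ∈ Λ_{i+1}, then xy ∈ E(H), for otherwise w_{i,x,y} has no colour left.
  colours-adjacent : ∀ {f i x y} → IsColoring f → (p : 1 ≤ i) (q : i ≤ d ∸ 2) → Λ i x → Λ (suc i) y →
                     c i x ≡ f (u i p (≤∸2⇒≤∸1 d q)) → c (suc i) y ≡ f (u (suc i) (s≤s z≤n) (suc≤∸1 d p q)) →
                     Adj x y
  colours-adjacent {f} {i} {x} {y} (inList , proper) p q lx ly fx fy with adj? x y
  ... | yes xy = xy
  ... | no ¬xy with inList (w i x y p q lx ly ¬xy)
  ...   | inj₁ e = ⊥-elim (proper (u i _ _) (w i x y p q lx ly ¬xy) (inj₁ refl) (sym (trans e fx)))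
  ...   | inj₂ e = ⊥-elim (proper (u (suc i) _ _) (w i x y p q lx ly ¬xy) (inj₂ refl) (sym (trans e fy)))

  outside-interior : ∀ {j} → j ≤ d → ¬ (1 ≤ j × j ≤ d ∸ 1) → j ≡ 0 ⊎ j ≡ d
  outside-interior {zero} _ _ = inj₁ refl
  outside-interior {suc j} le notInterior with m≤n⇒m<n∨m≡n le
  ... | inj₁ lt = ⊥-elim (notInterior (s≤s z≤n , <⇒≤pred lt))
  ... | inj₂ e = inj₂ e

  module _ {f : GV → C} (col : IsColoring f) (i : ℕ) (p : 1 ≤ i) (q : i ≤ d ∸ 1) where
    carrier : Fin n
    carrier = proj₁ (proj₁ col (u i p q))

    carrier-Λ : Λ i carrier
    carrier-Λ = proj₁ (proj₂ (proj₁ col (u i p q)))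

    carrier-colour : c i carrier ≡ f (u i p q)
    carrier-colour = proj₂ (proj₂ (proj₁ col (u i p q)))

  -- Decoding a colouring into an S-path, relative to a reference S-path P₀
  -- which supplies the endpoints s and t.
  module Decode (P₀ : Path) (w₀ : SPath H s t d P₀) where
    sp₀ = SPath⇒IsShortest {P₀} w₀

    opaque
      decodeAt : {f : GV → C} → IsColoring f → ℕ → Fin n
      decodeAt col j with 1 ≤? j | j ≤? d ∸ 1
      ... | yes p | yes q = carrier col j p q
      ... | _ | _ = at P₀ j

      decodeAt-cases : ∀ {f} (col : IsColoring f) j →
                       (Σ (1 ≤ j) λ p → Σ (j ≤ d ∸ 1) λ q → decodeAt col j ≡ carrier col j p q) ⊎
                       (¬ (1 ≤ j × j ≤ d ∸ 1) × decodeAt col j ≡ at P₀ j)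
      decodeAt-cases col j with 1 ≤? j | j ≤? d ∸ 1
      ... | yes p | yes q = inj₁ (p , q , refl)
      ... | yes p | no ¬q = inj₂ ((λ pq → ¬q (proj₂ pq)) , refl)
      ... | no ¬p | _ = inj₂ ((λ pq → ¬p (proj₁ pq)) , refl)

    decodeAt-shortest : ∀ {f} (col : IsColoring f) → IsShortest (decodeAt col)
    decodeAt-shortest col = start , end , step
      where
      start : decodeAt col 0 ≡ s
      start with decodeAt-cases col 0
      ... | inj₁ (() , _)
      ... | inj₂ (_ , e) = trans e (proj₁ sp₀)
      end : decodeAt col d ≡ t
      end with decodeAt-cases col d
      ... | inj₁ (p , q , _) = ⊥-elim (<⇒≱ (∸-monoʳ-< {o = 0} (s≤s z≤n) p) q)
      ... | inj₂ (_ , e) = trans e (proj₁ (proj₂ sp₀))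
      step : ∀ j → j < d → Adj (decodeAt col j) (decodeAt col (suc j))
      step j lt with decodeAt-cases col j | decodeAt-cases col (suc j)
      ... | inj₂ (_ , e) | inj₂ (_ , e') = subst₂ Adj (sym e) (sym e') (proj₂ (proj₂ sp₀) j lt)
      ... | inj₂ (outside , e) | inj₁ (p' , q' , e') with outside-interior (<⇒≤ lt) outside
      ...   | inj₂ refl = ⊥-elim (<-irrefl refl lt)
      ...   | inj₁ refl = subst₂ Adj (sym (trans e (proj₁ sp₀))) (sym e')
                            (distance1⇒Adj (proj₁ (carrier-Λ col 1 p' q')))
      step j lt | inj₁ (p , q , e) | inj₂ (outside , e') with outside-interior lt outside
      ...   | inj₂ refl = subst₂ Adj (sym e) (sym (trans e' (proj₁ (proj₂ sp₀))))
                            (Adj-sym (distance1⇒Adj (subst (Dist H t _) (m+n∸n≡m 1 j) (proj₂ (carrier-Λ col j p q)))))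
      step j lt | inj₁ (p , q , e) | inj₁ (p' , q' , e') =
        subst₂ Adj (sym e) (sym e')
          (colours-adjacent col p q₂ (carrier-Λ col j p q) (carrier-Λ col (suc j) p' q')
                            (carrier-colour col j p q) (carrier-colour col (suc j) p' q'))
        where q₂ = subst (j ≤_) (pred[m∸n]≡m∸[1+n] d 1) (pred-mono-≤ q')

    decode : {f : GV → C} → IsColoring f → Path
    decode col = tabulateℕ d (decodeAt col)

    decode-SPath : ∀ {f} (col : IsColoring f) → SPath H s t d (decode col)
    decode-SPath col = proj₂ (toIsWalk (decodeAt col , decodeAt-shortest col))

    at-decode : ∀ {f} (col : IsColoring f) j → j ≤ d → at (decode col) j ≡ decodeAt col j
    at-decode col = at-tabulateℕ d (decodeAt col)

    decode-differs : ∀ {f g} (col : IsColoring f) (col' : IsColoring g) j →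
                     at (decode col) j ≢ at (decode col') j → j ≤ d →
                     Σ (1 ≤ j) λ p → Σ (j ≤ d ∸ 1) λ q → f (u j p q) ≢ g (u j p q)
    decode-differs {f} {g} col col' j ne le
      with decodeAt-cases col j | decodeAt-cases col' j
    ... | inj₂ (_ , e) | inj₂ (_ , e') =
      ⊥-elim (ne (trans (at-decode col j le) (trans e (sym (trans (at-decode col' j le) e')))))
    ... | inj₁ (p , q , _) | inj₂ (outside , _) = ⊥-elim (outside (p , q))
    ... | inj₂ (outside , _) | inj₁ (p , q , _) = ⊥-elim (outside (p , q))
    ... | inj₁ (p , q , e) | inj₁ (_ , _ , e') = p , q , λ fg → ne (begin
      at (decode col) j     ≡⟨ trans (at-decode col j le) e ⟩
      carrier col j p q     ≡⟨ c-injective p q (carrier-Λ col j p q) (carrier-Λ col' j p q)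
                                 (trans (carrier-colour col j p q) (trans fg (sym (carrier-colour col' j p q)))) ⟩
      carrier col' j p q    ≡⟨ sym (trans (at-decode col' j le) e') ⟩
      at (decode col') j    ∎)
      where open ≡-Reasoning

    decode-≗ : ∀ {f g} (col : IsColoring f) (col' : IsColoring g) → f ≗ g → decode col ≡ decode col'
    decode-≗ col col' e = at-ext (decode col) (decode col') agree
      where
      agree : ∀ j → j ≤ d → at (decode col) j ≡ at (decode col') j
      agree j le with at (decode col) j ≟ᶠ at (decode col') j
      ... | yes same = same
      ... | no ne with decode-differs col col' j ne le
      ...   | p , q , fg = ⊥-elim (fg (e (u j p q)))

    decode-step : ∀ {f g} (col : IsColoring f) (col' : IsColoring g) → DiffOne f g →
                  decode col ≡ decode col' ⊎ AdjSPath H (decode col) (decode col')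
    decode-step {f} {g} col col' (a , _ , only) =
      equal-or-adjacent (decode-SPath col) (decode-SPath col') (proj₁ (proj₂ (moved a recoloured)))
                        (proj₂ (proj₂ (moved a recoloured)))
      where
      Differ : ℕ → Set
      Differ j = at (decode col) j ≢ at (decode col') j
      IsU : ℕ → GV → Set
      IsU j b = Σ (1 ≤ j) λ p → Σ (j ≤ d ∸ 1) λ q → u j p q ≡ b
      recoloured : ∀ j → j ≤ d → Differ j → IsU j a
      recoloured j le ne with decode-differs col col' j ne le
      ... | p , q , fg = p , q , only (u j p q) fg
      moved : ∀ b → (∀ j → j ≤ d → Differ j → IsU j b) →
              Σ ℕ λ k → k ≤ d × (∀ j → j ≤ d → Differ j → j ≡ k)
      moved (u k p q) at-b = k , interior⇒≤ (recompute-≤ q) , λ j le ne → index j (at-b j le ne)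
        where
        index : ∀ j → IsU j (u k p q) → j ≡ k
        index j (_ , _ , refl) = refl
      moved (w i x y p q lx ly nxy) at-b = 0 , z≤n , λ j le ne → absurd j (at-b j le ne)
        where
        absurd : ∀ j → IsU j (w i x y p q lx ly nxy) → j ≡ 0
        absurd j (_ , _ , ())

    decode-compatible : ∀ {f} (col : IsColoring f) {P : Path} → SPath H s t d P →
                        Compatible (at P) f → decode col ≡ P
    decode-compatible {f} col {P} wp (onU , _) = at-ext (decode col) P λ j le →
      trans (at-decode col j le) (same j le)
      where
      sp = SPath⇒IsShortest {P} wp
      endpoint : ∀ {j} → j ≡ 0 ⊎ j ≡ d → at P₀ j ≡ at P j
      endpoint (inj₁ refl) = trans (proj₁ sp₀) (sym (proj₁ sp))
      endpoint (inj₂ refl) = trans (proj₁ (proj₂ sp₀)) (sym (proj₁ (proj₂ sp)))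
      same : ∀ j → j ≤ d → decodeAt col j ≡ at P j
      same j le with decodeAt-cases col j
      ... | inj₁ (p , q , e) =
        trans e (c-injective p q (carrier-Λ col j p q) (shortest-InLayer sp j le)
                   (trans (carrier-colour col j p q) (onU j p q)))
      ... | inj₂ (outside , e) = trans e (endpoint (outside-interior le outside))

    Reconf-start : ∀ {f g} → Reconf f g → IsColoring f
    Reconf-start (stop col _) = col
    Reconf-start (move col _ _) = col

    Reconf⇒SPathChain : ∀ {f g} (rc : Reconf f g) (col : IsColoring g) →
                        SPathChain (decode (Reconf-start rc)) (decode col)
    Reconf⇒SPathChain (stop col' e) col =
      subst (SPathChain _) (decode-≗ col' col e) [ decode-SPath col' ]
    Reconf⇒SPathChain (move col' step rest) col with decode-step col' (Reconf-start rest) step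
    ... | inj₁ same = subst (λ P → SPathChain P (decode col)) (sym same) (Reconf⇒SPathChain rest col)
    ... | inj₂ adj = decode-SPath col' ∷⟨ adj ⟩ Reconf⇒SPathChain rest col

  backward : ∀ {P₀ Pᵣ : Path} {f₀ fᵣ} → SPath H s t d P₀ → SPath H s t d Pᵣ →
             FromSPath P₀ f₀ → FromSPath Pᵣ fᵣ → ReconfPath f₀ fᵣ → SPathSeq H s t d P₀ Pᵣ
  backward {P₀} {Pᵣ} {f₀} {fᵣ} w₀ wᵣ from₀ fromᵣ path =
    SPathChain⇒SPathSeq (subst₂ SPathChain (decode-compatible (Reconf-start rc) w₀ compatible₀)
                                           (decode-compatible colᵣ wᵣ compatibleᵣ)
                                           (Reconf⇒SPathChain rc colᵣ))
    where
    open Decode P₀ w₀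
    rc = ReconfPath⇒Reconf path
    compatible₀ = FromSPath⇒Compatible {P₀} {f₀} w₀ from₀
    compatibleᵣ = FromSPath⇒Compatible {Pᵣ} {fᵣ} wᵣ fromᵣ
    colᵣ = Compatible⇒IsColoring (SPath⇒IsShortest {Pᵣ} wᵣ) compatibleᵣ

lemma1 : (H : Graph) (s t : Fin (Graph.n H)) (d : ℕ) → Dist H s t d →
         (P₀ Pᵣ : Vec (Fin (Graph.n H)) (suc d)) →
         SPath H s t d P₀ → SPath H s t d Pᵣ →
         {C : Set} (c : ℕ → Fin (Graph.n H) → C) → DistinctColors H s t d c →
         (f₀ fᵣ : Construction.GV H s t d c → C) →
         Construction.FromSPath H s t d c P₀ f₀ →
         Construction.FromSPath H s t d c Pᵣ fᵣ →
         (SPathSeq H s t d P₀ Pᵣ ⇔ Construction.ReconfPath H s t d c f₀ fᵣ)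
lemma1 H s t d dst P₀ Pᵣ w₀ wᵣ c distinct f₀ fᵣ from₀ fromᵣ =
  mk⇔ (forward {P₀} {Pᵣ} {f₀} {fᵣ} w₀ wᵣ from₀ fromᵣ) (backward {P₀} {Pᵣ} {f₀} {fᵣ} w₀ wᵣ from₀ fromᵣ)
  where open Instance H s t d dst c distinct
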